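{- Let $n\ge1$ and $e\in\mathcal{D}(n)$. Then $e$ is a join-irreducible element of $\mathcal{D}(n)$ if and only if $\tilde{\mathsf{s}}(e)$ is the indicator vector of a principal order ideal of $\mathcal{F}(n)$.
   Context: $\beta(n)=b_1\cdots b_k$ is the binary expansion ($b_1=1$ most significant); its principal prefix is $b_1\cdots b_r$, where $b_{r+1}$ is the rightmost $0$ ($r=0$ if none). A hyperbinary expansion of $n$ is a word $d_1\cdots d_k$ over $\{0,1,2\}$ with $\sum_id_i2^{k-i}=n$, corresponding to the hyperbinary partition (parts powers of $2$, each at most twice) in which $2^{k-i}$ has multiplicity $d_i$; $\mathcal{D}(n)$ is the set of these ordered by transporting refinement of partitions ($\mu\le\lambda$ if the parts of $\lambda$ can be subdivided to produce the parts of $\mu$); it is a lattice with minimum $\hat0$. For a word $c$, $s_j(c)=\sum_{i=1}^jc_i2^{j-i}$, $\mathsf{s}(c)=(s_1(c),\dots,s_r(c))$, and $\tilde{\mathsf{s}}(c)=\mathsf{s}(c)-\mathsf{s}(\hat0)\in\mathbb{Z}^r$. The fence $\mathcal{F}(n)$ is the poset on $\{x_1,\dots,x_r\}$ whose covers are, for $2\le i\le r$: $x_i$ covered by $x_{i-1}$ if $b_i=0$, and $x_i$ covers $x_{i-1}$ if $b_i=1$. The indicator vector of $I\subseteq\mathcal{F}(n)$ is $(\chi_1,\dots,\chi_r)$ with $\chi_i=1$ if $x_i\in I$ and $0$ otherwise. A principal order ideal is one of the form $\{y: y\le x\}$. -}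

module Defs where

open import Data.Nat using (ℕ; zero; suc; _+_; _*_; _∸_; _^_; _≤_; _≟_)
open import Data.Nat.DivMod using (_/_; _%_)
open import Data.Integer as ℤ using (ℤ; +_)
open import Data.List using (List; []; _∷_; _++_; replicate; length; reverse; dropWhile; take; concat; foldl)
open import Data.Nat.ListAction using (sum)
open import Data.List.Relation.Unary.All using (All)
open import Data.List.Relation.Binary.Pointwise using (Pointwise)
open import Data.List.Relation.Binary.Permutation.Propositional using (_↭_)
open import Data.Product using (Σ; ∃; _×_)
open import Data.Sum using (_⊎_)
open import Relation.Nullary using (¬_)
open import Relation.Binary.PropositionalEquality using (_≡_)
open import Relation.Binary.Construct.Closure.ReflexiveTransitive using (Star)

-- Words are lists of natural-number digits, most significant first.

-- binary expansion (reversed, lsb first), with fuel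
binRev : ℕ → ℕ → List ℕ
binRev zero    _       = []
binRev (suc f) zero    = []
binRev (suc f) (suc m) = (suc m % 2) ∷ binRev f (suc m / 2)

β : ℕ → List ℕ
β n = reverse (binRev n n)

val : List ℕ → ℕ
val = foldl (λ acc d → 2 * acc + d) 0

s : ℕ → List ℕ → ℕ
s j c = val (take j c)

-- length r of the principal prefix of β(n): b_{r+1} is the rightmost 0, r = 0 if none
principalLength : ℕ → ℕ
principalLength n = length (dropWhile (λ x → x ≟ 1) (reverse (β n))) ∸ 1

IsHB : ℕ → List ℕ → Set
IsHB n w = (length w ≡ length (β n)) × All (_≤ 2) w × (val w ≡ n)

parts : List ℕ → List ℕ
parts []       = []
parts (d ∷ ds) = replicate d (2 ^ length ds) ++ parts ds

Refines : List ℕ → List ℕ → Set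
Refines μ λ′ = Σ (List (List ℕ)) λ blocks →
  Pointwise (λ blk p → sum blk ≡ p) blocks λ′ × (concat blocks ↭ μ)

_≼_ : List ℕ → List ℕ → Set
w ≼ v = Refines (parts w) (parts v)

IsMinimum : ℕ → List ℕ → Set
IsMinimum n z = IsHB n z × (∀ x → IsHB n x → z ≼ x)

IsJoin : ℕ → List ℕ → List ℕ → List ℕ → Set
IsJoin n a b e = IsHB n e × a ≼ e × b ≼ e ×
  (∀ c → IsHB n c → a ≼ c → b ≼ c → e ≼ c)

JoinIrreducible : ℕ → List ℕ → Set
JoinIrreducible n e = (¬ (∀ x → IsHB n x → e ≼ x)) ×
  (∀ a b → IsHB n a → IsHB n b → IsJoin n a b e → (e ≡ a) ⊎ (e ≡ b))

-- i-th letter (1-indexed) of a word, default 0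
nth : List ℕ → ℕ → ℕ
nth []       _             = 0
nth (x ∷ xs) zero          = 0
nth (x ∷ xs) (suc zero)    = x
nth (x ∷ xs) (suc (suc i)) = nth xs (suc i)

-- cover relations of the fence ℱ(n) on x₁ … x_r (elements indexed 1..r):
-- FCover n i j means x_i is covered by x_j
data FCover (n : ℕ) : ℕ → ℕ → Set where
  down : ∀ {i} → 2 ≤ i → i ≤ principalLength n → nth (β n) i ≡ 0 → FCover n i (i ∸ 1)
  up   : ∀ {i} → 2 ≤ i → i ≤ principalLength n → nth (β n) i ≡ 1 → FCover n (i ∸ 1) i

_≤F[_]_ : ℕ → ℕ → ℕ → Set
i ≤F[ n ] j = Star (FCover n) i j

IsIndicator : ℕ → (ℕ → ℤ) → (ℕ → Set) → Set
IsIndicator r v I = ∀ i → 1 ≤ i → i ≤ r →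
  (I i → v i ≡ + 1) × (¬ I i → v i ≡ + 0)

IsPrincipalIdealIndicator : ℕ → (ℕ → ℤ) → Set
IsPrincipalIdealIndicator n v = ∃ λ x → 1 ≤ x × x ≤ principalLength n ×
  IsIndicator (principalLength n) v (λ y → y ≤F[ n ] x)

-- s̃(c)_j = s_j(c) - s_j(0̂), for the minimum 0̂ = z
sTilde : List ℕ → List ℕ → ℕ → ℤ
sTilde z c j = + s j c ℤ.- + s j z

module Submission where

-- Compare an expansion w of n with the binary one through its lag  lag w j = s_j(β n) ∸ s_j(w).
-- The lag is 0 or 1, vanishes at 0 and beyond the principal prefix, and consecutive values obey
-- letter_{j+1} + lag_{j+1} = b_{j+1} + 2 lag_j; conversely every such sequence is the lag of exactly
-- one expansion.  Refining a hyperbinary partition can only lower the prefix sums s_j (count the parts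
-- of size ≥ 2^i), and conversely lower prefix sums can be realised by splitting parts in halves, so
-- w ≼ v iff lag v ≤ lag w pointwise.  For 0/1 sequences the local rule says exactly that the zero set of
-- the lag is an order ideal of the fence, so 𝒟(n) is the lattice of order ideals of ℱ(n), 0̂ has lag 1
-- on 1 … r, and s̃(e) = 1 - lag e is the indicator of the ideal of e.
-- A principal ideal ↓x is join-irreducible since an ideal containing x contains ↓x.  Conversely, walk
-- rightwards through a join-irreducible ideal from its least element: a gap in the ideal, or a valley of
-- the fence inside it, would cut it into two smaller ideals whose union it is.  So the ideal is an
-- interval on which the fence rises to a single peak x and then falls, i.e. it is ↓x.

open import Defs
open import Data.Nat using (ℕ; zero; suc; pred; _+_; _*_; _∸_; _^_; _≤_; _<_; _≟_; _≤?_; z≤n; s≤s)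
open import Data.Nat.Properties
open import Data.Nat.DivMod using (_/_; _%_; m≡m%n+[m/n]*n; m%n<n; m/n<m)
open import Data.Nat.Tactic.RingSolver using (solve-∀)
open import Data.List
  using (List; []; _∷_; _++_; [_]; replicate; length; reverse; dropWhile; take; drop; foldl; concat; map; filter; applyUpTo)
open import Data.List.Properties
  using (foldl-++; length-take; take-all; length-drop; take++drop≡id; length-++; ++-assoc; ++-identityʳ;
         reverse-++; reverse-involutive; unfold-reverse; length-reverse; length-replicate;
         concat-++; concat-concat; concat-map-[_]; filter-++; filter-all; filter-none; filter-accept; filter-reject;
         length-applyUpTo; applyUpTo-∷ʳ)
open import Data.Nat.ListAction using (sum)
open import Data.Nat.ListAction.Properties using (sum-++; sum-↭)
open import Data.List.Relation.Binary.Pointwise as Pointwise using (Pointwise; []; _∷_)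
open import Data.List.Relation.Binary.Permutation.Propositional as ↭ using (_↭_; ↭-refl; ↭-reflexive; ↭-trans; prep; swap)
import Data.List.Relation.Binary.Permutation.Propositional.Properties as ↭
open import Data.List.Relation.Unary.All as All using (All; []; _∷_)
import Data.List.Relation.Unary.All.Properties as All
import Data.Integer as ℤ
open import Data.Integer.Properties using ([+m]-[+n]≡m⊖n; +-cancelˡ-⊖)
open import Data.Product using (∃-syntax; _×_; _,_; proj₁; proj₂)
open import Data.Sum as Sum using (_⊎_; inj₁; inj₂; [_,_]′)
open import Function using (_∘_)
open import Data.Empty using (⊥; ⊥-elim)
open import Relation.Nullary using (¬_; Dec; yes; no; _×-dec_)
open import Relation.Binary.Construct.Closure.ReflexiveTransitive using (ε; _◅_; _◅◅_)
open import Relation.Binary.Definitions using (tri<; tri≈; tri>)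
open import Function.Bundles using (_⇔_; mk⇔)
open import Relation.Binary.PropositionalEquality
  using (_≡_; _≢_; refl; sym; trans; cong; cong₂; subst; subst₂; module ≡-Reasoning)

quotient-≤ : ∀ {a c p x} → a * p ≤ x → x < suc c * p → a ≤ c
quotient-≤ {a} {c} {p} ap≤x x<cp = ≤-pred (*-cancelʳ-< p a (suc c) (≤-<-trans ap≤x x<cp))

m*n≤m : ∀ m {n} → n ≤ 1 → m * n ≤ m
m*n≤m m n≤1 = ≤-trans (*-monoʳ-≤ m n≤1) (≤-reflexive (*-identityʳ m))

m*n≤n : ∀ {m} n → m ≤ 1 → m * n ≤ n
m*n≤n n m≤1 = ≤-trans (*-monoˡ-≤ n m≤1) (≤-reflexive (+-identityʳ n))

zero-product : ∀ x y → x ≡ 0 ⊎ y ≡ 0 → x * y ≡ 0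
zero-product x y (inj₁ refl) = refl
zero-product x y (inj₂ refl) = *-zeroʳ x

least-or-none : ∀ {P : ℕ → Set} → (∀ i → Dec (P i)) → ∀ q →
  (∃[ p ] p ≤ q × P p × (∀ i → i < p → ¬ P i)) ⊎ (∀ i → i ≤ q → ¬ P i)
least-or-none P? zero with P? 0
... | yes P0  = inj₁ (0 , z≤n , P0 , λ _ ())
... | no  ¬P0 = inj₂ λ { zero _ → ¬P0 }
least-or-none P? (suc q) with least-or-none P? q
... | inj₁ (p , p≤q , Pp , below) = inj₁ (p , m≤n⇒m≤1+n p≤q , Pp , below)
... | inj₂ none with P? (suc q)
...   | yes Pq  = inj₁ (suc q , ≤-refl , Pq , λ i i≤q → none i (≤-pred i≤q))
...   | no  ¬Pq = inj₂ λ i i≤q+1 → [ (λ i≤q → none i (≤-pred i≤q)) , (λ { refl → ¬Pq }) ]′ (m≤n⇒m<n∨m≡n i≤q+1)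

-- Values and prefix sums of words

foldl-val : ∀ acc xs → foldl (λ acc d → 2 * acc + d) acc xs ≡ acc * 2 ^ length xs + val xs
foldl-val acc []       = sym (trans (+-identityʳ _) (*-identityʳ acc))
foldl-val acc (x ∷ xs) = begin
  foldl (λ acc d → 2 * acc + d) (2 * acc + x) xs  ≡⟨ foldl-val (2 * acc + x) xs ⟩
  (2 * acc + x) * p + val xs                      ≡⟨ distrib acc x p (val xs) ⟩
  acc * (2 * p) + (x * p + val xs)                ≡⟨ cong (acc * (2 * p) +_) (foldl-val x xs) ⟨
  acc * (2 * p) + val (x ∷ xs)                    ∎
  where
  open ≡-Reasoning
  p = 2 ^ length xs
  distrib : ∀ a y p v → (2 * a + y) * p + v ≡ a * (2 * p) + (y * p + v)
  distrib = solve-∀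

val-∷ : ∀ x xs → val (x ∷ xs) ≡ x * 2 ^ length xs + val xs
val-∷ = foldl-val

val-++ : ∀ xs ys → val (xs ++ ys) ≡ val xs * 2 ^ length ys + val ys
val-++ xs ys = trans (foldl-++ _ 0 xs ys) (foldl-val (val xs) ys)

val-∷ʳ : ∀ xs x → val (xs ++ [ x ]) ≡ 2 * val xs + x
val-∷ʳ xs x = foldl-++ _ 0 xs [ x ]

val-bound : ∀ c xs → All (_≤ c) xs → val xs + c ≤ c * 2 ^ length xs
val-bound c []       []       = ≤-reflexive (sym (*-identityʳ c))
val-bound c (x ∷ xs) (x≤c ∷ xs≤c) = begin
  val (x ∷ xs) + c           ≡⟨ cong (_+ c) (val-∷ x xs) ⟩
  x * p + val xs + c         ≡⟨ +-assoc (x * p) (val xs) c ⟩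
  x * p + (val xs + c)       ≤⟨ +-mono-≤ (*-monoˡ-≤ p x≤c) (val-bound c xs xs≤c) ⟩
  c * p + c * p              ≡⟨ double c p ⟩
  c * (2 * p)                ∎
  where
  open ≤-Reasoning
  p = 2 ^ length xs
  double : ∀ c p → c * p + c * p ≡ c * (2 * p)
  double = solve-∀

s-all : ∀ j w → length w ≤ j → s j w ≡ val w
s-all j w le = cong val (take-all j w le)

s-suc-∷ : ∀ j x xs → j ≤ length xs → s (suc j) (x ∷ xs) ≡ x * 2 ^ j + s j xs
s-suc-∷ j x xs le = trans (val-∷ x (take j xs))
  (cong (λ l → x * 2 ^ l + s j xs) (trans (length-take j xs) (m≤n⇒m⊓n≡m le)))

take-suc-nth : ∀ i w → i < length w → take (suc i) w ≡ take i w ++ [ nth w (suc i) ]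
take-suc-nth zero    (x ∷ w) _       = refl
take-suc-nth (suc i) (x ∷ w) (s≤s lt) = cong (x ∷_) (take-suc-nth i w lt)

s-suc : ∀ i w → i < length w → s (suc i) w ≡ 2 * s i w + nth w (suc i)
s-suc i w lt = trans (cong val (take-suc-nth i w lt)) (val-∷ʳ (take i w) (nth w (suc i)))

val-take-drop : ∀ j w → j ≤ length w → val w ≡ s j w * 2 ^ (length w ∸ j) + val (drop j w)
val-take-drop j w le = trans (cong val (sym (take++drop≡id j w)))
  (trans (val-++ (take j w) (drop j w)) (cong (λ l → s j w * 2 ^ l + val (drop j w)) (length-drop j w)))

prefix-bounds : ∀ {c j v} → j ≤ length v → 1 ≤ c → All (_≤ c) v →
  s j v * 2 ^ (length v ∸ j) ≤ val v × val v < (c + s j v) * 2 ^ (length v ∸ j)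
prefix-bounds {c} {j} {v} j≤ 1≤c v≤c = ≤-trans (m≤m+n _ _) (≤-reflexive (sym split)) , (begin-strict
  val v                          ≡⟨ split ⟩
  s j v * p + val (drop j v)     <⟨ +-monoʳ-< (s j v * p) (<-≤-trans (m<m+n _ 1≤c) rest≤) ⟩
  s j v * p + c * p              ≡⟨ +-comm (s j v * p) (c * p) ⟩
  c * p + s j v * p              ≡⟨ *-distribʳ-+ p c (s j v) ⟨
  (c + s j v) * p                ∎)
  where
  open ≤-Reasoning
  p = 2 ^ (length v ∸ j)
  split : val v ≡ s j v * p + val (drop j v)
  split = val-take-drop j v j≤
  rest≤ : val (drop j v) + c ≤ c * p
  rest≤ = subst (λ l → val (drop j v) + c ≤ c * 2 ^ l) (length-drop j v) (val-bound c (drop j v) (All.drop⁺ j v≤c))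

nth-All : ∀ {P : ℕ → Set} xs → All P xs → P 0 → ∀ i → P (nth xs i)
nth-All []       _          p0 i             = p0
nth-All (x ∷ xs) _          p0 zero          = p0
nth-All (x ∷ xs) (px ∷ _)   p0 (suc zero)    = px
nth-All (x ∷ xs) (_ ∷ pxs)  p0 (suc (suc i)) = nth-All xs pxs p0 (suc i)

nth-++ : ∀ xs ys i → nth (xs ++ ys) (length xs + suc i) ≡ nth ys (suc i)
nth-++ []       ys i = refl
nth-++ (x ∷ xs) ys i rewrite +-suc (length xs) i = trans (cong (nth (xs ++ ys)) (sym (+-suc (length xs) i))) (nth-++ xs ys i)

nth-replicate : ∀ p i → 1 ≤ i → i ≤ p → nth (replicate p 1) i ≡ 1
nth-replicate (suc p) (suc zero)    _ _        = refl
nth-replicate (suc p) (suc (suc i)) _ (s≤s le) = nth-replicate p (suc i) (s≤s z≤n) le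

take-applyUpTo : ∀ (g : ℕ → ℕ) {j m} → j ≤ m → take j (applyUpTo g m) ≡ applyUpTo g j
take-applyUpTo g {zero}  _        = refl
take-applyUpTo g {suc j} (s≤s le) = cong (g 0 ∷_) (take-applyUpTo (λ i → g (suc i)) le)

-- The binary expansion and its principal prefix

All-reverse : ∀ {P : ℕ → Set} {xs} → All P xs → All P (reverse xs)
All-reverse {P} {[]}     []         = []
All-reverse {P} {x ∷ xs} (px ∷ pxs) = subst (All P) (sym (unfold-reverse x xs)) (All.++⁺ (All-reverse pxs) (px ∷ []))

reverse-replicate : ∀ p (x : ℕ) → reverse (replicate p x) ≡ replicate p x
reverse-replicate zero    x = refl
reverse-replicate (suc p) x = begin
  reverse (x ∷ replicate p x)       ≡⟨ unfold-reverse x (replicate p x) ⟩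
  reverse (replicate p x) ++ [ x ]  ≡⟨ cong (_++ [ x ]) (reverse-replicate p x) ⟩
  replicate p x ++ [ x ]            ≡⟨ replicate-∷ʳ p ⟩
  x ∷ replicate p x                 ∎
  where
  open ≡-Reasoning
  replicate-∷ʳ : ∀ q → replicate q x ++ [ x ] ≡ x ∷ replicate q x
  replicate-∷ʳ zero    = refl
  replicate-∷ʳ (suc q) = cong (x ∷_) (replicate-∷ʳ q)

drop-ones : List ℕ → List ℕ
drop-ones = dropWhile (_≟ 1)

drop-ones-shape : ∀ R → All (_≤ 1) R →
  ∃[ p ] (R ≡ replicate p 1 ++ drop-ones R) × (drop-ones R ≡ [] ⊎ ∃[ D ] drop-ones R ≡ 0 ∷ D)
drop-ones-shape []            _               = 0 , refl , inj₁ refl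
drop-ones-shape (.0 ∷ R)      (z≤n ∷ _)       = 0 , refl , inj₂ (R , refl)
drop-ones-shape (.1 ∷ R)      (s≤s z≤n ∷ R≤1) with drop-ones-shape R R≤1
... | p , R≡ , rest = suc p , cong (1 ∷_) R≡ , rest

data OnesSuffix (L : List ℕ) (r : ℕ) : Set where
  all-ones  : L ≡ replicate (length L) 1 → r ≡ 0 → OnesSuffix L r
  last-zero : ∀ P p → L ≡ P ++ 0 ∷ replicate p 1 → length P ≡ r → OnesSuffix L r

ones-suffix : ∀ L → All (_≤ 1) L → OnesSuffix L (length (drop-ones (reverse L)) ∸ 1)
ones-suffix L L≤1 with drop-ones-shape (reverse L) (All-reverse L≤1)
... | p , L≡ , inj₁ empty = all-ones L≡ones (cong (λ l → length l ∸ 1) empty)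
  where
  L≡p-ones : L ≡ replicate p 1
  L≡p-ones = begin
    L                                   ≡⟨ reverse-involutive L ⟨
    reverse (reverse L)                 ≡⟨ cong reverse (trans L≡ (cong (replicate p 1 ++_) empty)) ⟩
    reverse (replicate p 1 ++ [])       ≡⟨ cong reverse (++-identityʳ (replicate p 1)) ⟩
    reverse (replicate p 1)             ≡⟨ reverse-replicate p 1 ⟩
    replicate p 1                       ∎
    where open ≡-Reasoning
  L≡ones : L ≡ replicate (length L) 1
  L≡ones = trans L≡p-ones (cong (λ q → replicate q 1) (trans (sym (length-replicate p)) (cong length (sym L≡p-ones))))
... | p , L≡ , inj₂ (D , D≡) =
  last-zero (reverse D) p L≡zero (trans (length-reverse D) (sym (cong (λ l → length l ∸ 1) D≡)))
  where
  L≡zero : L ≡ reverse D ++ 0 ∷ replicate p 1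
  L≡zero = begin
    L                                            ≡⟨ reverse-involutive L ⟨
    reverse (reverse L)                          ≡⟨ cong reverse (trans L≡ (cong (replicate p 1 ++_) D≡)) ⟩
    reverse (replicate p 1 ++ 0 ∷ D)             ≡⟨ reverse-++ (replicate p 1) (0 ∷ D) ⟩
    reverse (0 ∷ D) ++ reverse (replicate p 1)   ≡⟨ cong₂ _++_ (unfold-reverse 0 D) (reverse-replicate p 1) ⟩
    (reverse D ++ [ 0 ]) ++ replicate p 1        ≡⟨ ++-assoc (reverse D) [ 0 ] (replicate p 1) ⟩
    reverse D ++ 0 ∷ replicate p 1               ∎
    where open ≡-Reasoning

binRev-digits : ∀ f m → All (_≤ 1) (binRev f m)
binRev-digits zero    m       = []
binRev-digits (suc f) zero    = []
binRev-digits (suc f) (suc m) = ≤-pred (m%n<n (suc m) 2) ∷ binRev-digits f (suc m / 2)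

half-≤ : ∀ m → suc m / 2 ≤ m
half-≤ zero    = z≤n
half-≤ (suc m) = ≤-pred (m/n<m (suc (suc m)) 2 (s≤s (s≤s z≤n)))

val-binRev : ∀ f m → m ≤ f → val (reverse (binRev f m)) ≡ m
val-binRev zero    zero    _        = refl
val-binRev (suc f) zero    _        = refl
val-binRev (suc f) (suc m) (s≤s le) = begin
  val (reverse (d ∷ binRev f q))         ≡⟨ cong val (unfold-reverse d (binRev f q)) ⟩
  val (reverse (binRev f q) ++ [ d ])    ≡⟨ val-∷ʳ (reverse (binRev f q)) d ⟩
  2 * val (reverse (binRev f q)) + d     ≡⟨ cong (λ v → 2 * v + d) (val-binRev f q (≤-trans (half-≤ m) le)) ⟩
  2 * q + d                              ≡⟨ trans (+-comm (2 * q) d) (cong (d +_) (*-comm 2 q)) ⟩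
  d + q * 2                              ≡⟨ m≡m%n+[m/n]*n (suc m) 2 ⟨
  suc m                                  ∎
  where
  open ≡-Reasoning
  d = suc m % 2
  q = suc m / 2

binRev-last : ∀ f m → 1 ≤ m → m ≤ f → ∃[ xs ] binRev f m ≡ xs ++ [ 1 ]
binRev-last (suc f) (suc m) _ (s≤s le) with suc m / 2 in half
... | zero = [] , cong₂ _∷_ odd (binRev-zero f)
  where
  m≡ : suc m ≡ suc m % 2
  m≡ = trans (m≡m%n+[m/n]*n (suc m) 2) (trans (cong (λ q → suc m % 2 + q * 2) half) (+-identityʳ _))
  odd : suc m % 2 ≡ 1
  odd = trans (sym m≡) (cong suc (n≤0⇒n≡0 (≤-pred (≤-trans (≤-reflexive m≡) (≤-pred (m%n<n (suc m) 2))))))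
  binRev-zero : ∀ f → binRev f 0 ≡ []
  binRev-zero zero    = refl
  binRev-zero (suc f) = refl
... | suc q with binRev-last f (suc q) (s≤s z≤n) (≤-trans (≤-reflexive (sym half)) (≤-trans (half-≤ m) le))
...   | xs , eq = suc m % 2 ∷ xs , cong (suc m % 2 ∷_) eq

module Binary (n : ℕ) (1≤n : 1 ≤ n) where

  k r : ℕ
  k = length (β n)
  r = principalLength n

  b : ℕ → ℕ
  b = nth (β n)

  val-β : val (β n) ≡ n
  val-β = val-binRev n n ≤-refl

  β-digits : All (_≤ 1) (β n)
  β-digits = All-reverse (binRev-digits n n)

  b≤1 : ∀ i → b i ≤ 1
  b≤1 = nth-All (β n) β-digits z≤n

  β-shape : OnesSuffix (β n) r
  β-shape = ones-suffix (β n) β-digits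

  β-leading : ∃[ xs ] β n ≡ 1 ∷ xs
  β-leading with binRev-last n n 1≤n ≤-refl
  ... | xs , eq = reverse xs , trans (cong reverse eq) (reverse-++ xs [ 1 ])

  b₁≡1 : b 1 ≡ 1
  b₁≡1 with β-leading
  ... | xs , eq = cong (λ l → nth l 1) eq

  r<k : r < k
  r<k with β-shape | β-leading
  ... | all-ones _ r≡0 | xs , eq = subst (_< k) (sym r≡0) (subst (λ l → 0 < length l) (sym eq) (s≤s z≤n))
  ... | last-zero P p eq |P|≡r | _ = subst (_< k) |P|≡r (subst (λ l → length P < length l) (sym eq)
          (subst (length P <_) (sym (length-++ P)) (m<m+n (length P) (s≤s z≤n))))

  b-after-r : 1 ≤ r → b (suc r) ≡ 0
  b-after-r 1≤r with β-shape
  ... | all-ones _ r≡0 = ⊥-elim (1+n≰n (subst (1 ≤_) r≡0 1≤r))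
  ... | last-zero P p eq |P|≡r = begin
    nth (β n) (suc r)                                ≡⟨ cong₂ nth eq (cong suc (sym |P|≡r)) ⟩
    nth (P ++ 0 ∷ replicate p 1) (suc (length P))    ≡⟨ cong (nth (P ++ 0 ∷ replicate p 1)) (+-comm 1 (length P)) ⟩
    nth (P ++ 0 ∷ replicate p 1) (length P + 1)      ≡⟨ nth-++ P (0 ∷ replicate p 1) 0 ⟩
    0                                                ∎
    where open ≡-Reasoning

  b-tail : ∀ j → suc r < j → j ≤ k → b j ≡ 1
  b-tail j r+1<j j≤k with β-shape | m≤n⇒∃[o]m+o≡n r+1<j
  ... | all-ones eq _ | _ = trans (cong (λ l → nth l j) eq) (nth-replicate k j (≤-trans (s≤s z≤n) r+1<j) j≤k)
  ... | last-zero P p eq |P|≡r | d , refl = begin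
    nth (β n) (suc (suc r) + d)                            ≡⟨ cong₂ nth eq j≡ ⟩
    nth (P ++ 0 ∷ replicate p 1) (length P + suc (suc d))  ≡⟨ nth-++ P (0 ∷ replicate p 1) (suc d) ⟩
    nth (replicate p 1) (suc d)                            ≡⟨ nth-replicate p (suc d) (s≤s z≤n) d<p ⟩
    1                                                      ∎
    where
    open ≡-Reasoning
    j≡ : suc (suc r) + d ≡ length P + suc (suc d)
    j≡ = trans (cong (λ q → suc (suc q) + d) (sym |P|≡r))
           (sym (trans (+-suc (length P) (suc d)) (cong suc (+-suc (length P) d))))
    |β|≡ : k ≡ length P + suc p
    |β|≡ = trans (cong length eq) (trans (length-++ P) (cong (λ q → length P + suc q) (length-replicate p)))
    d<p : suc d ≤ p
    d<p = ≤-pred (+-cancelˡ-≤ (length P) _ _ (subst₂ _≤_ j≡ |β|≡ j≤k))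

-- Refinement of partitions and prefix sums

SumsTo : List ℕ → ℕ → Set
SumsTo blk p = sum blk ≡ p

refines-refl : ∀ μ → Refines μ μ
refines-refl μ = map [_] μ , singletons μ , ↭-reflexive (concat-map-[ μ ])
  where
  singletons : ∀ xs → Pointwise SumsTo (map [_] xs) xs
  singletons []       = []
  singletons (x ∷ xs) = +-identityʳ x ∷ singletons xs

refines-++ : ∀ {μ₁ λ₁ μ₂ λ₂} → Refines μ₁ λ₁ → Refines μ₂ λ₂ → Refines (μ₁ ++ μ₂) (λ₁ ++ λ₂)
refines-++ (B₁ , sums₁ , perm₁) (B₂ , sums₂ , perm₂) =
  B₁ ++ B₂ , Pointwise.++⁺ sums₁ sums₂ , ↭-trans (↭-reflexive (sym (concat-++ B₁ B₂))) (↭.++⁺ perm₁ perm₂)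

pointwise-↭ : ∀ {R : List ℕ → ℕ → Set} {B ν ν′} → Pointwise R B ν → ν′ ↭ ν →
  ∃[ B′ ] (B′ ↭ B) × Pointwise R B′ ν′
pointwise-↭ {B = B} rel ↭.refl = B , ↭-refl , rel
pointwise-↭ (r ∷ rel) (prep x p) with pointwise-↭ rel p
... | B′ , B′↭ , rel′ = _ , prep _ B′↭ , r ∷ rel′
pointwise-↭ (r₁ ∷ r₂ ∷ rel) (swap x y p) with pointwise-↭ rel p
... | B′ , B′↭ , rel′ = _ , swap _ _ B′↭ , r₂ ∷ r₁ ∷ rel′
pointwise-↭ rel (↭.trans p q) with pointwise-↭ rel q
... | B₁ , B₁↭ , rel₁ with pointwise-↭ rel₁ p
...   | B₂ , B₂↭ , rel₂ = B₂ , ↭-trans B₂↭ B₁↭ , rel₂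

pointwise-++ʳ : ∀ {R : List ℕ → ℕ → Set} {B} ys zs → Pointwise R B (ys ++ zs) →
  ∃[ B₁ ] ∃[ B₂ ] (B ≡ B₁ ++ B₂) × Pointwise R B₁ ys × Pointwise R B₂ zs
pointwise-++ʳ []       zs rel = [] , _ , refl , [] , rel
pointwise-++ʳ (y ∷ ys) zs (r ∷ rel) with pointwise-++ʳ ys zs rel
... | B₁ , B₂ , eq , rel₁ , rel₂ = _ ∷ B₁ , B₂ , cong (_ ∷_) eq , r ∷ rel₁ , rel₂

pointwise-concat : ∀ {B} C → Pointwise SumsTo B (concat C) →
  ∃[ G ] (concat G ≡ B) × Pointwise (Pointwise SumsTo) G C
pointwise-concat []      []  = [] , refl , []
pointwise-concat (c ∷ C) rel with pointwise-++ʳ c (concat C) rel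
... | B₁ , B₂ , eq , rel₁ , rel₂ with pointwise-concat C rel₂
...   | G , G≡ , relG = B₁ ∷ G , trans (cong (B₁ ++_) G≡) (sym eq) , rel₁ ∷ relG

sum-concat : ∀ {G c} → Pointwise SumsTo G c → sum (concat G) ≡ sum c
sum-concat []                     = refl
sum-concat {blk ∷ G} (eq ∷ rel) = trans (sum-++ blk (concat G)) (cong₂ _+_ eq (sum-concat rel))

concat-↭ : ∀ {B′ B : List (List ℕ)} → B′ ↭ B → concat B′ ↭ concat B
concat-↭ ↭.refl                = ↭-refl
concat-↭ (prep x p)            = ↭.++⁺ˡ x (concat-↭ p)
concat-↭ (swap {B′} {B} x y p) = begin
  x ++ y ++ concat B′   ≡⟨ ++-assoc x y (concat B′) ⟨
  (x ++ y) ++ concat B′ ↭⟨ ↭.++⁺ (↭.++-comm x y) (concat-↭ p) ⟩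
  (y ++ x) ++ concat B  ≡⟨ ++-assoc y x (concat B) ⟩
  y ++ x ++ concat B    ∎
  where open ↭.PermutationReasoning
concat-↭ (↭.trans p q)         = ↭-trans (concat-↭ p) (concat-↭ q)

refines-trans : ∀ {μ ν λ′} → Refines μ ν → Refines ν λ′ → Refines μ λ′
refines-trans (B , sumsB , permB) (C , sumsC , permC) with pointwise-↭ sumsB permC
... | B′ , B′↭B , sumsB′ with pointwise-concat C sumsB′
...   | G , G≡ , sumsG =
  map concat G , regroup sumsG sumsC , ↭-trans (↭-reflexive concat≡) (↭-trans (concat-↭ B′↭B) permB)
  where
  regroup : ∀ {G C λ′} → Pointwise (Pointwise SumsTo) G C → Pointwise SumsTo C λ′ → Pointwise SumsTo (map concat G) λ′
  regroup []           []           = []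
  regroup (rel ∷ rels) (eq ∷ sums) = trans (sum-concat rel) eq ∷ regroup rels sums
  concat≡ : concat (map concat G) ≡ concat B′
  concat≡ = trans (concat-concat G) (cong concat G≡)

sum≥ : ℕ → List ℕ → ℕ
sum≥ m xs = sum (filter (m ≤?_) xs)

sum≥-++ : ∀ m xs ys → sum≥ m (xs ++ ys) ≡ sum≥ m xs + sum≥ m ys
sum≥-++ m xs ys = trans (cong sum (filter-++ (m ≤?_) xs ys)) (sum-++ (filter (m ≤?_) xs) _)

sum≥-↭ : ∀ m {xs ys} → xs ↭ ys → sum≥ m xs ≡ sum≥ m ys
sum≥-↭ m p = sum-↭ (↭.filter-↭ (m ≤?_) p)

sum≥-≤-sum : ∀ m xs → sum≥ m xs ≤ sum xs
sum≥-≤-sum m []       = z≤n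
sum≥-≤-sum m (x ∷ xs) with m ≤? x
... | yes m≤x = subst (_≤ x + sum xs) (sym (cong sum (filter-accept (m ≤?_) m≤x))) (+-monoʳ-≤ x (sum≥-≤-sum m xs))
... | no  m≰x = subst (_≤ x + sum xs) (sym (cong sum (filter-reject (m ≤?_) m≰x)))
                      (≤-trans (sum≥-≤-sum m xs) (m≤n+m (sum xs) x))

sum≥-all : ∀ m {xs} → All (m ≤_) xs → sum≥ m xs ≡ sum xs
sum≥-all m all = cong sum (filter-all (m ≤?_) all)

sum≥-none : ∀ m {xs} → All (_< m) xs → sum≥ m xs ≡ 0
sum≥-none m all = cong sum (filter-none (m ≤?_) (All.map <⇒≱ all))

≤-sum : ∀ xs → All (_≤ sum xs) xs
≤-sum []       = []
≤-sum (x ∷ xs) = m≤m+n x (sum xs) ∷ All.map (λ {y} y≤ → ≤-trans y≤ (m≤n+m (sum xs) x)) (≤-sum xs)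

sum≥-block : ∀ m blk → sum≥ m blk ≤ sum≥ m [ sum blk ]
sum≥-block m blk with m ≤? sum blk
... | yes m≤ = subst (sum≥ m blk ≤_) (sym (trans (sum≥-all m (m≤ ∷ [])) (+-identityʳ (sum blk)))) (sum≥-≤-sum m blk)
... | no  m≰ = ≤-reflexive (trans (sum≥-none m (All.map (λ x≤ → ≤-<-trans x≤ (≰⇒> m≰)) (≤-sum blk)))
                                  (sym (sum≥-none m (≰⇒> m≰ ∷ []))))

sum≥-concat : ∀ m {B λ′} → Pointwise SumsTo B λ′ → sum≥ m (concat B) ≤ sum≥ m λ′
sum≥-concat m []                                = z≤n
sum≥-concat m {blk ∷ B} {_ ∷ λ′} (refl ∷ sums) = begin
  sum≥ m (blk ++ concat B)          ≡⟨ sum≥-++ m blk (concat B) ⟩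
  sum≥ m blk + sum≥ m (concat B)    ≤⟨ +-mono-≤ (sum≥-block m blk) (sum≥-concat m sums) ⟩
  sum≥ m [ sum blk ] + sum≥ m λ′    ≡⟨ sum≥-++ m [ sum blk ] λ′ ⟨
  sum≥ m (sum blk ∷ λ′)             ∎
  where open ≤-Reasoning

refines⇒sum≥-≤ : ∀ m {μ λ′} → Refines μ λ′ → sum≥ m μ ≤ sum≥ m λ′
refines⇒sum≥-≤ m (B , sums , perm) = subst (_≤ _) (sum≥-↭ m perm) (sum≥-concat m sums)

sum-replicate : ∀ d x → sum (replicate d x) ≡ d * x
sum-replicate zero    x = refl
sum-replicate (suc d) x = cong (x +_) (sum-replicate d x)

parts-< : ∀ w → All (_< 2 ^ length w) (parts w)
parts-< []       = []
parts-< (d ∷ ds) = All.++⁺ (All.replicate⁺ d next<) (All.map (λ p< → <-trans p< next<) (parts-< ds))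
  where
  next< : 2 ^ length ds < 2 ^ suc (length ds)
  next< = ^-monoʳ-< 2 (s≤s (s≤s z≤n)) (n<1+n (length ds))

sum≥-parts : ∀ j i w → length w ≡ j + i → sum≥ (2 ^ i) (parts w) ≡ s j w * 2 ^ i
sum≥-parts zero    i w        |w|≡ = sum≥-none (2 ^ i) (subst (λ l → All (_< 2 ^ l) (parts w)) |w|≡ (parts-< w))
sum≥-parts (suc j) i (d ∷ ds) |w|≡ = begin
  sum≥ q (replicate d (2 ^ length ds) ++ parts ds)               ≡⟨ sum≥-++ q (replicate d _) (parts ds) ⟩
  sum≥ q (replicate d (2 ^ length ds)) + sum≥ q (parts ds)       ≡⟨ cong₂ _+_ big (sum≥-parts j i ds |ds|≡) ⟩
  d * 2 ^ (j + i) + s j ds * q                                   ≡⟨ cong (λ v → d * v + s j ds * q) (^-distribˡ-+-* 2 j i) ⟩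
  d * (2 ^ j * q) + s j ds * q                                   ≡⟨ factor d (2 ^ j) q (s j ds) ⟩
  (d * 2 ^ j + s j ds) * q                                       ≡⟨ cong (_* q) (s-suc-∷ j d ds (subst (j ≤_) (sym |ds|≡) (m≤m+n j i))) ⟨
  s (suc j) (d ∷ ds) * q                                         ∎
  where
  open ≡-Reasoning
  q = 2 ^ i
  |ds|≡ : length ds ≡ j + i
  |ds|≡ = suc-injective |w|≡
  big : sum≥ (2 ^ i) (replicate d (2 ^ length ds)) ≡ d * 2 ^ (j + i)
  big = trans (sum≥-all (2 ^ i) (All.replicate⁺ d (^-monoʳ-≤ 2 (subst (i ≤_) (sym |ds|≡) (m≤n+m i j)))))
              (trans (sum-replicate d _) (cong (λ l → d * 2 ^ l) |ds|≡))
  factor : ∀ a x y z → a * (x * y) + z * y ≡ (a * x + z) * y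
  factor = solve-∀

-- The parts ≥ 2 ^ i of parts w come from its first j letters, and subdividing can only lower their total.
refines⇒s-≤ : ∀ {a c} j → Refines (parts a) (parts c) → length a ≡ length c → j ≤ length a → s j a ≤ s j c
refines⇒s-≤ {a} {c} j ref |a|≡|c| j≤ = *-cancelʳ-≤ (s j a) (s j c) (2 ^ i) {{m^n≢0 2 i}}
  (subst₂ _≤_ (sum≥-parts j i a |a|≡) (sum≥-parts j i c (trans (sym |a|≡|c|) |a|≡)) (refines⇒sum≥-≤ (2 ^ i) ref))
  where
  i = length a ∸ j
  |a|≡ : length a ≡ j + i
  |a|≡ = sym (m+[n∸m]≡n j≤)

replicate-+ : ∀ p q (x : ℕ) → replicate (p + q) x ≡ replicate p x ++ replicate q x
replicate-+ zero    q x = refl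
replicate-+ (suc p) q x = cong (x ∷_) (replicate-+ p q x)

refines-halve : ∀ m h → Refines (replicate (2 * m) h) (replicate m (2 * h))
refines-halve m h = replicate m (h ∷ h ∷ []) , Pointwise.replicate⁺ refl m , ↭-reflexive (concat-pairs m)
  where
  concat-pairs : ∀ m → concat (replicate m (h ∷ h ∷ [])) ≡ replicate (2 * m) h
  concat-pairs zero    = refl
  concat-pairs (suc m) = cong (h ∷_) (trans (cong (h ∷_) (concat-pairs m)) (cong (λ q → replicate q h) (sym (+-suc m (m + 0)))))

refines-borrow : ∀ a m c cs → let h = 2 ^ length cs in
  Refines (replicate a (2 * h) ++ parts ((2 * m + c) ∷ cs)) (parts ((a + m) ∷ c ∷ cs))
refines-borrow a m c cs = subst₂ Refines lhs≡ rhs≡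
  (refines-++ (refines-refl (replicate a (2 * h))) (refines-++ (refines-halve m h) (refines-refl rest)))
  where
  h = 2 ^ length cs
  rest = replicate c h ++ parts cs
  lhs≡ : replicate a (2 * h) ++ replicate (2 * m) h ++ rest ≡ replicate a (2 * h) ++ replicate (2 * m + c) h ++ parts cs
  lhs≡ = cong (replicate a (2 * h) ++_)
              (trans (sym (++-assoc (replicate (2 * m) h) _ _)) (cong (_++ parts cs) (sym (replicate-+ (2 * m) c h))))
  rhs≡ : replicate a (2 * h) ++ replicate m (2 * h) ++ rest ≡ replicate (a + m) (2 * h) ++ rest
  rhs≡ = trans (sym (++-assoc (replicate a (2 * h)) _ _)) (cong (_++ rest) (sym (replicate-+ a m (2 * h))))

s-borrow : ∀ j m c cs → j ≤ length cs →
  s (suc j) ((2 * m + c) ∷ cs) ≡ m * 2 ^ suc j + s (suc j) (c ∷ cs)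
s-borrow j m c cs j≤ = begin
  s (suc j) ((2 * m + c) ∷ cs)          ≡⟨ s-suc-∷ j (2 * m + c) cs j≤ ⟩
  (2 * m + c) * 2 ^ j + s j cs          ≡⟨ distrib m c (2 ^ j) (s j cs) ⟩
  m * 2 ^ suc j + (c * 2 ^ j + s j cs)  ≡⟨ cong (m * 2 ^ suc j +_) (s-suc-∷ j c cs j≤) ⟨
  m * 2 ^ suc j + s (suc j) (c ∷ cs)    ∎
  where
  open ≡-Reasoning
  distrib : ∀ m c p v → (2 * m + c) * p + v ≡ m * (2 * p) + (c * p + v)
  distrib = solve-∀

-- With c₁ = a₁ + m, keep a₁ parts of c, halve the other m parts into the next letter, and recurse.
prefix-≤⇒refines : ∀ a c → length a ≡ length c → val a ≡ val c → (∀ j → j ≤ length a → s j a ≤ s j c) →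
  Refines (parts a) (parts c)
prefix-≤⇒refines []          []             _       _     _   = refines-refl []
prefix-≤⇒refines (_ ∷ _ ∷ _) (_ ∷ [])       ()      _     _
prefix-≤⇒refines (a₁ ∷ [])   (c₁ ∷ [])      _       a₁≡c₁ _   =
  subst (λ x → Refines (parts [ a₁ ]) (parts [ x ])) a₁≡c₁ (refines-refl _)
prefix-≤⇒refines (a₁ ∷ as)   (c₁ ∷ c₂ ∷ cs) |a|≡|c| va≡vc a≤c =
  subst (λ l → Refines (replicate a₁ (2 ^ l) ++ parts as) (parts (c₁ ∷ c₂ ∷ cs))) (sym |as|≡)
    (refines-trans (refines-++ (refines-refl (replicate a₁ (2 * h))) IH)
                   (subst (λ x → Refines (replicate a₁ (2 * h) ++ parts cs′) (parts (x ∷ c₂ ∷ cs))) (sym c₁≡)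
                          (refines-borrow a₁ m c₂ cs)))
  where
  h = 2 ^ length cs
  m = c₁ ∸ a₁
  c₁≡ : c₁ ≡ a₁ + m
  c₁≡ = sym (m+[n∸m]≡n (a≤c 1 (s≤s z≤n)))
  cs′ = (2 * m + c₂) ∷ cs
  |as|≡ : length as ≡ suc (length cs)
  |as|≡ = suc-injective |a|≡|c|
  s-c≡ : ∀ j → j ≤ length cs → s (suc (suc j)) (c₁ ∷ c₂ ∷ cs) ≡ a₁ * 2 ^ suc j + s (suc j) cs′
  s-c≡ j j≤ = begin
    s (suc (suc j)) (c₁ ∷ c₂ ∷ cs)                        ≡⟨ s-suc-∷ (suc j) c₁ (c₂ ∷ cs) (s≤s j≤) ⟩
    c₁ * 2 ^ suc j + s (suc j) (c₂ ∷ cs)                  ≡⟨ cong (λ x → x * 2 ^ suc j + s (suc j) (c₂ ∷ cs)) c₁≡ ⟩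
    (a₁ + m) * 2 ^ suc j + s (suc j) (c₂ ∷ cs)            ≡⟨ assoc a₁ m (2 ^ suc j) _ ⟩
    a₁ * 2 ^ suc j + (m * 2 ^ suc j + s (suc j) (c₂ ∷ cs)) ≡⟨ cong (a₁ * 2 ^ suc j +_) (s-borrow j m c₂ cs j≤) ⟨
    a₁ * 2 ^ suc j + s (suc j) cs′                        ∎
    where
    open ≡-Reasoning
    assoc : ∀ a m p v → (a + m) * p + v ≡ a * p + (m * p + v)
    assoc = solve-∀
  s-a≡ : ∀ j → j ≤ length cs → s (suc (suc j)) (a₁ ∷ as) ≡ a₁ * 2 ^ suc j + s (suc j) as
  s-a≡ j j≤ = s-suc-∷ (suc j) a₁ as (subst (suc j ≤_) (sym |as|≡) (s≤s j≤))
  L = length cs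
  val-as≡ : val as ≡ val cs′
  val-as≡ = +-cancelˡ-≡ (a₁ * 2 ^ suc L) _ _ (begin
    a₁ * 2 ^ suc L + val as        ≡⟨ cong (a₁ * 2 ^ suc L +_) (s-all (suc L) as (≤-reflexive |as|≡)) ⟨
    a₁ * 2 ^ suc L + s (suc L) as  ≡⟨ s-a≡ L ≤-refl ⟨
    s (suc (suc L)) (a₁ ∷ as)      ≡⟨ s-all (suc (suc L)) (a₁ ∷ as) (≤-reflexive (cong suc |as|≡)) ⟩
    val (a₁ ∷ as)                  ≡⟨ va≡vc ⟩
    val (c₁ ∷ c₂ ∷ cs)             ≡⟨ s-all (suc (suc L)) (c₁ ∷ c₂ ∷ cs) ≤-refl ⟨
    s (suc (suc L)) (c₁ ∷ c₂ ∷ cs) ≡⟨ s-c≡ L ≤-refl ⟩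
    a₁ * 2 ^ suc L + s (suc L) cs′ ≡⟨ cong (a₁ * 2 ^ suc L +_) (s-all (suc L) cs′ ≤-refl) ⟩
    a₁ * 2 ^ suc L + val cs′       ∎)
    where open ≡-Reasoning
  as≤cs′ : ∀ j → j ≤ length as → s j as ≤ s j cs′
  as≤cs′ zero    _  = z≤n
  as≤cs′ (suc j) j< =
    +-cancelˡ-≤ (a₁ * 2 ^ suc j) _ _ (subst₂ _≤_ (s-a≡ j j≤) (s-c≡ j j≤) (a≤c (suc (suc j)) (s≤s j<)))
    where
    j≤ : j ≤ length cs
    j≤ = ≤-pred (subst (suc j ≤_) |as|≡ j<)
  IH : Refines (parts as) (parts cs′)
  IH = prefix-≤⇒refines as cs′ |as|≡ val-as≡ as≤cs′

s-injective : ∀ a c → length a ≡ length c → (∀ j → j ≤ length a → s j a ≡ s j c) → a ≡ c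
s-injective []       []       _       _    = refl
s-injective (x ∷ xs) (y ∷ ys) |a|≡|c| a≡c = cong₂ _∷_ x≡y (s-injective xs ys (suc-injective |a|≡|c|) xs≡ys)
  where
  x≡y : x ≡ y
  x≡y = a≡c 1 (s≤s z≤n)
  xs≡ys : ∀ j → j ≤ length xs → s j xs ≡ s j ys
  xs≡ys j j≤ = +-cancelˡ-≡ (x * 2 ^ j) _ _ (begin
    x * 2 ^ j + s j xs   ≡⟨ s-suc-∷ j x xs j≤ ⟨
    s (suc j) (x ∷ xs)   ≡⟨ a≡c (suc j) (s≤s j≤) ⟩
    s (suc j) (y ∷ ys)   ≡⟨ s-suc-∷ j y ys (subst (j ≤_) (suc-injective |a|≡|c|) j≤) ⟩
    y * 2 ^ j + s j ys   ≡⟨ cong (λ v → v * 2 ^ j + s j ys) x≡y ⟨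
    x * 2 ^ j + s j ys   ∎)
    where open ≡-Reasoning

-- Lag sequences

-- the letter bit + 2 p ∸ q between lag values p and q lies in {0, 1, 2}
record LagStep (bit p q : ℕ) : Set where
  constructor lagStep
  field
    lower : q ≤ bit + 2 * p
    upper : bit + 2 * p ≤ 2 + q

step-down : ∀ {q} → LagStep 0 0 q → q ≡ 0
step-down {zero}  _       = refl
step-down {suc q} (lagStep () _)

step-up : ∀ {p} → LagStep 1 p 0 → p ≡ 0
step-up {zero}  _                 = refl
step-up {suc p} (lagStep _ (s≤s (s≤s h))) with ≤-trans (≤-reflexive (sym (+-suc p (p + 0)))) h
... | ()

step-01 : LagStep 1 0 1
step-01 = lagStep (s≤s z≤n) (s≤s z≤n)

step-10 : LagStep 0 1 0
step-10 = lagStep z≤n ≤-refl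

step-00 : ∀ {bit} → bit ≤ 1 → LagStep bit 0 0
step-00 bit≤1 = lagStep z≤n (≤-trans (≤-reflexive (+-identityʳ _)) (≤-trans bit≤1 (s≤s z≤n)))

step-11 : ∀ {bit} → bit ≤ 1 → LagStep bit 1 1
step-11 bit≤1 = lagStep (≤-trans (s≤s z≤n) (m≤n+m 2 _)) (+-monoˡ-≤ 2 bit≤1)

step-cast : ∀ {bit bit′ p p′ q q′} → bit ≡ bit′ → p ≡ p′ → q ≡ q′ → LagStep bit′ p′ q′ → LagStep bit p q
step-cast refl refl refl st = st

-- For 0/1 values the only forbidden steps are (0, 0, 1) and (1, 1, 0): this is the order-ideal condition.
step-intro : ∀ {bit p q} → bit ≤ 1 → p ≤ 1 → q ≤ 1 →
  (bit ≡ 0 → p ≡ 0 → q ≡ 0) → (bit ≡ 1 → q ≡ 0 → p ≡ 0) → LagStep bit p q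
step-intro z≤n       z≤n       z≤n       _    _  = step-00 z≤n
step-intro z≤n       z≤n       (s≤s z≤n) desc _ = ⊥-elim (1+n≢0 (desc refl refl))
step-intro z≤n       (s≤s z≤n) z≤n       _    _  = step-10
step-intro z≤n       (s≤s z≤n) (s≤s z≤n) _    _  = step-11 z≤n
step-intro (s≤s z≤n) z≤n       z≤n       _    _  = step-00 ≤-refl
step-intro (s≤s z≤n) z≤n       (s≤s z≤n) _    _  = step-01
step-intro (s≤s z≤n) (s≤s z≤n) z≤n       _ asc = ⊥-elim (1+n≢0 (asc refl refl))
step-intro (s≤s z≤n) (s≤s z≤n) (s≤s z≤n) _    _  = step-11 ≤-refl

glue : ℕ → (ℕ → ℕ) → (ℕ → ℕ) → ℕ → ℕ
glue m f g j with j ≤? m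
... | yes _ = f j
... | no  _ = g j

glue-≤ : ∀ {m} f g {j} → j ≤ m → glue m f g j ≡ f j
glue-≤ {m} _ _ {j} j≤m with j ≤? m
... | yes _   = refl
... | no  j≰m = ⊥-elim (j≰m j≤m)

glue-> : ∀ {m} f g {j} → m < j → glue m f g j ≡ g j
glue-> {m} _ _ {j} m<j with j ≤? m
... | yes j≤m = ⊥-elim (<⇒≱ m<j j≤m)
... | no  _   = refl

glue-elim : ∀ {m j} f g (P : ℕ → Set) → (j ≤ m → P (f j)) → (m < j → P (g j)) → P (glue m f g j)
glue-elim {m} {j} _ _ P here there with j ≤? m
... | yes j≤m = here j≤m
... | no  j≰m = there (≰⇒> j≰m)

module Lags (n : ℕ) (1≤n : 1 ≤ n) where
  open Binary n 1≤n public

  N : ℕ → ℕ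
  N j = s j (β n)

  lag : List ℕ → ℕ → ℕ
  lag w j = N j ∸ s j w

  record IsLag (t : ℕ → ℕ) : Set where
    field
      ≤1       : ∀ j → t j ≤ 1
      at-0     : t 0 ≡ 0
      beyond-r : ∀ j → r < j → t j ≡ 0
      step     : ∀ i → i < k → LagStep (b (suc i)) (t i) (t (suc i))

  same-length : ∀ {a c} → IsHB n a → IsHB n c → length a ≡ length c
  same-length (|a|≡k , _) (|c|≡k , _) = trans |a|≡k (sym |c|≡k)

  module Expansion {w : List ℕ} (hb : IsHB n w) where
    private
      |w|≡k   = proj₁ hb
      w-digits = proj₁ (proj₂ hb)
      val-w   = proj₂ (proj₂ hb)

    s-beyond-k : ∀ j → k ≤ j → s j w ≡ N j
    s-beyond-k j k≤j =
      trans (s-all j w (subst (_≤ j) (sym |w|≡k) k≤j)) (trans val-w (sym (trans (s-all j (β n) k≤j) val-β)))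

    s≤N≤1+s : ∀ j → j ≤ k → s j w ≤ N j × N j ≤ suc (s j w)
    s≤N≤1+s j j≤k = quotient-≤ (proj₁ w-bounds) (proj₂ β-bounds) , quotient-≤ (proj₁ β-bounds) (proj₂ w-bounds)
      where
      bounds : ∀ {c v} → length v ≡ k → val v ≡ n → 1 ≤ c → All (_≤ c) v →
        s j v * 2 ^ (k ∸ j) ≤ n × n < (c + s j v) * 2 ^ (k ∸ j)
      bounds {c} {v} |v|≡k val-v 1≤c v≤c =
        subst₂ (λ l x → s j v * 2 ^ (l ∸ j) ≤ x × x < (c + s j v) * 2 ^ (l ∸ j)) |v|≡k val-v
               (prefix-bounds (subst (j ≤_) (sym |v|≡k) j≤k) 1≤c v≤c)
      w-bounds = bounds |w|≡k val-w (s≤s z≤n) w-digits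
      β-bounds = bounds refl val-β ≤-refl β-digits

    s+lag : ∀ j → j ≤ k → s j w + lag w j ≡ N j
    s+lag j j≤k = m+[n∸m]≡n (proj₁ (s≤N≤1+s j j≤k))

    lag-beyond-k : ∀ j → k ≤ j → lag w j ≡ 0
    lag-beyond-k j k≤j = trans (cong (N j ∸_) (s-beyond-k j k≤j)) (n∸n≡0 (N j))

    lag≤1 : ∀ j → lag w j ≤ 1
    lag≤1 j with j ≤? k
    ... | yes j≤k = m≤n+o⇒m∸n≤o (N j) (s j w) (subst (N j ≤_) (+-comm 1 (s j w)) (proj₂ (s≤N≤1+s j j≤k)))
    ... | no  j≰k = ≤-trans (≤-reflexive (lag-beyond-k j (<⇒≤ (≰⇒> j≰k)))) z≤n

    lag-step : ∀ i → i < k → LagStep (b (suc i)) (lag w i) (lag w (suc i))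
    lag-step i i<k = lagStep (subst (lag w (suc i) ≤_) letter≡ (m≤n+m _ d))
                             (subst (_≤ 2 + lag w (suc i)) letter≡ (+-monoˡ-≤ _ (nth-All w w-digits z≤n (suc i))))
      where
      d = nth w (suc i)
      letter≡ : d + lag w (suc i) ≡ b (suc i) + 2 * lag w i
      letter≡ = +-cancelˡ-≡ (2 * s i w) _ _ (begin
        2 * s i w + (d + lag w (suc i))       ≡⟨ +-assoc (2 * s i w) d _ ⟨
        2 * s i w + d + lag w (suc i)         ≡⟨ cong (_+ lag w (suc i)) (s-suc i w (subst (i <_) (sym |w|≡k) i<k)) ⟨
        s (suc i) w + lag w (suc i)           ≡⟨ s+lag (suc i) i<k ⟩
        N (suc i)                             ≡⟨ s-suc i (β n) i<k ⟩
        2 * N i + b (suc i)                   ≡⟨ cong (λ v → 2 * v + b (suc i)) (s+lag i (<⇒≤ i<k)) ⟨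
        2 * (s i w + lag w i) + b (suc i)     ≡⟨ rearrange (s i w) (lag w i) (b (suc i)) ⟩
        2 * s i w + (b (suc i) + 2 * lag w i) ∎)
        where
        open ≡-Reasoning
        rearrange : ∀ x y z → 2 * (x + y) + z ≡ 2 * x + (z + 2 * y)
        rearrange = solve-∀

    lag-beyond-r : ∀ j → r < j → lag w j ≡ 0
    lag-beyond-r j r<j = descend (k ∸ j) j refl r<j
      where
      descend : ∀ d j → d ≡ k ∸ j → r < j → lag w j ≡ 0
      descend zero    j d≡ _   = lag-beyond-k j (m∸n≡0⇒m≤n (sym d≡))
      descend (suc d) j d≡ r<j = step-up (step-cast (sym (b-tail (suc j) (s≤s r<j) j<k)) refl (sym next≡0) (lag-step j j<k))
        where
        j<k : j < k
        j<k = m∸n≢0⇒n<m (λ k∸j≡0 → 0≢1+n (trans (sym k∸j≡0) (sym d≡)))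
        next≡0 : lag w (suc j) ≡ 0
        next≡0 = descend d (suc j) (trans (cong pred d≡) (pred[m∸n]≡m∸[1+n] k j)) (≤-trans r<j (n≤1+n j))

    lag-IsLag : IsLag (lag w)
    lag-IsLag = record { ≤1 = lag≤1 ; at-0 = refl ; beyond-r = lag-beyond-r ; step = lag-step }

  module FromLag {t : ℕ → ℕ} (t-lag : IsLag t) where
    open IsLag t-lag

    -- the letter at position i + 1 forced by  letter + t (i + 1) ≡ b (i + 1) + 2 * t i
    letter : ℕ → ℕ
    letter i = b (suc i) + 2 * t i ∸ t (suc i)

    word : List ℕ
    word = applyUpTo letter k

    letter≤2 : ∀ {i} → i < k → letter i ≤ 2
    letter≤2 {i} i<k =
      m≤n+o⇒m∸n≤o _ (t (suc i)) (subst (b (suc i) + 2 * t i ≤_) (+-comm 2 (t (suc i))) (LagStep.upper (step i i<k)))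

    val-prefix : ∀ j → j ≤ k → val (applyUpTo letter j) + t j ≡ N j
    val-prefix zero    _   = at-0
    val-prefix (suc j) j<k = begin
      val (applyUpTo letter (suc j)) + t (suc j)            ≡⟨ cong (λ l → val l + t (suc j)) (applyUpTo-∷ʳ letter j) ⟨
      val (applyUpTo letter j ++ [ letter j ]) + t (suc j)  ≡⟨ cong (_+ t (suc j)) (val-∷ʳ (applyUpTo letter j) (letter j)) ⟩
      2 * v + letter j + t (suc j)                          ≡⟨ +-assoc (2 * v) (letter j) (t (suc j)) ⟩
      2 * v + (letter j + t (suc j))                        ≡⟨ cong (2 * v +_) (m∸n+n≡m (LagStep.lower (step j j<k))) ⟩
      2 * v + (b (suc j) + 2 * t j)                         ≡⟨ rearrange v (t j) (b (suc j)) ⟩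
      2 * (v + t j) + b (suc j)                             ≡⟨ cong (λ x → 2 * x + b (suc j)) (val-prefix j (<⇒≤ j<k)) ⟩
      2 * N j + b (suc j)                                   ≡⟨ s-suc j (β n) j<k ⟨
      N (suc j)                                             ∎
      where
      open ≡-Reasoning
      v = val (applyUpTo letter j)
      rearrange : ∀ x y z → 2 * x + (z + 2 * y) ≡ 2 * (x + y) + z
      rearrange = solve-∀

    s+t : ∀ j → j ≤ k → s j word + t j ≡ N j
    s+t j j≤k = trans (cong (λ l → val l + t j) (take-applyUpTo letter j≤k)) (val-prefix j j≤k)

    word-IsHB : IsHB n word
    word-IsHB = length-applyUpTo letter k , All.applyUpTo⁺₁ letter k letter≤2 , (begin
      val word           ≡⟨ +-identityʳ (val word) ⟨
      val word + 0       ≡⟨ cong (val word +_) (beyond-r k r<k) ⟨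
      val word + t k     ≡⟨ val-prefix k ≤-refl ⟩
      N k                ≡⟨ s-all k (β n) ≤-refl ⟩
      val (β n)          ≡⟨ val-β ⟩
      n                  ∎)
      where open ≡-Reasoning

    lag-word : ∀ j → lag word j ≡ t j
    lag-word j with j ≤? k
    ... | yes j≤k = trans (cong (_∸ s j word) (sym (s+t j j≤k))) (m+n∸m≡n (s j word) (t j))
    ... | no  j≰k =
      trans (Expansion.lag-beyond-k word-IsHB j (<⇒≤ (≰⇒> j≰k))) (sym (beyond-r j (<-trans r<k (≰⇒> j≰k))))

  ≼⇒lag-≥ : ∀ {a c} → IsHB n a → IsHB n c → a ≼ c → ∀ j → lag c j ≤ lag a j
  ≼⇒lag-≥ ha hc a≼c j with j ≤? k
  ... | yes j≤k = ∸-monoʳ-≤ (N j) (refines⇒s-≤ j a≼c (same-length ha hc) (subst (j ≤_) (sym (proj₁ ha)) j≤k))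
  ... | no  j≰k = ≤-trans (≤-reflexive (Expansion.lag-beyond-k hc j (<⇒≤ (≰⇒> j≰k)))) z≤n

  lag-≥⇒≼ : ∀ {a c} → IsHB n a → IsHB n c → (∀ j → lag c j ≤ lag a j) → a ≼ c
  lag-≥⇒≼ {a} {c} ha hc lag≥ =
    prefix-≤⇒refines a c (same-length ha hc) (trans (proj₂ (proj₂ ha)) (sym (proj₂ (proj₂ hc)))) λ j j≤ →
      +-cancelʳ-≤ (lag c j) (s j a) (s j c) (begin
        s j a + lag c j   ≤⟨ +-monoʳ-≤ (s j a) (lag≥ j) ⟩
        s j a + lag a j   ≡⟨ Expansion.s+lag ha j (subst (j ≤_) (proj₁ ha) j≤) ⟩
        N j               ≡⟨ Expansion.s+lag hc j (subst (j ≤_) (proj₁ ha) j≤) ⟨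
        s j c + lag c j   ∎)
    where open ≤-Reasoning

  lag-injective : ∀ {a c} → IsHB n a → IsHB n c → (∀ j → lag a j ≡ lag c j) → a ≡ c
  lag-injective {a} {c} ha hc lag≡ = s-injective a c (same-length ha hc) λ j j≤ →
    +-cancelʳ-≡ (lag a j) (s j a) (s j c) (begin
      s j a + lag a j   ≡⟨ Expansion.s+lag ha j (subst (j ≤_) (proj₁ ha) j≤) ⟩
      N j               ≡⟨ Expansion.s+lag hc j (subst (j ≤_) (proj₁ ha) j≤) ⟨
      s j c + lag c j   ≡⟨ cong (s j c +_) (lag≡ j) ⟨
      s j c + lag a j   ∎)
    where open ≡-Reasoning

  module _ {t : ℕ → ℕ} (t-lag : IsLag t) where
    open IsLag t-lag

    step-at : ∀ {i bit p q} → i < k → b (suc i) ≡ bit → t i ≡ p → t (suc i) ≡ q → LagStep bit p q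
    step-at {i} i<k bit≡ p≡ q≡ = step-cast (sym bit≡) (sym p≡) (sym q≡) (step i i<k)

    zero-right : ∀ {i} → i < k → b (suc i) ≡ 0 → t i ≡ 0 → t (suc i) ≡ 0
    zero-right i<k b≡0 ti≡0 = step-down (step-at i<k b≡0 ti≡0 refl)

    zero-left : ∀ {i} → i < k → b (suc i) ≡ 1 → t (suc i) ≡ 0 → t i ≡ 0
    zero-left i<k b≡1 ti+1≡0 = step-up (step-at i<k b≡1 refl ti+1≡0)

    lag-downset : ∀ {i x} → i ≤F[ n ] x → t x ≡ 0 → t i ≡ 0
    lag-downset ε              tx≡0 = tx≡0
    lag-downset (cover ◅ path) tx≡0 = cover-downset cover (lag-downset path tx≡0)
      where
      cover-downset : ∀ {i j} → FCover n i j → t j ≡ 0 → t i ≡ 0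
      cover-downset (down {i} 2≤i i≤r b≡0) = below i 2≤i i≤r b≡0
        where
        below : ∀ i → 2 ≤ i → i ≤ r → b i ≡ 0 → t (i ∸ 1) ≡ 0 → t i ≡ 0
        below (suc i) _ i<r = zero-right (<-≤-trans i<r (<⇒≤ r<k))
      cover-downset (up {i} 2≤i i≤r b≡1) = above i 2≤i i≤r b≡1
        where
        above : ∀ i → 2 ≤ i → i ≤ r → b i ≡ 1 → t i ≡ 0 → t (i ∸ 1) ≡ 0
        above (suc i) _ i<r = zero-left (<-≤-trans i<r (<⇒≤ r<k))

  lag-* : ∀ {f g} → IsLag f → IsLag g → IsLag (λ j → f j * g j)
  lag-* {f} {g} f-lag g-lag = record
    { ≤1       = ≤1
    ; at-0     = cong (_* g 0) F.at-0
    ; beyond-r = λ j r<j → cong (_* g j) (F.beyond-r j r<j)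
    ; step     = λ i i<k → step-intro (b≤1 (suc i)) (≤1 i) (≤1 (suc i)) (right i<k) (left i<k)
    }
    where
    module F = IsLag f-lag
    module G = IsLag g-lag
    ≤1 : ∀ j → f j * g j ≤ 1
    ≤1 j = *-mono-≤ (F.≤1 j) (G.≤1 j)
    right : ∀ {i} → i < k → b (suc i) ≡ 0 → f i * g i ≡ 0 → f (suc i) * g (suc i) ≡ 0
    right {i} i<k b≡0 = zero-product (f (suc i)) (g (suc i))
                      ∘ Sum.map (zero-right f-lag i<k b≡0) (zero-right g-lag i<k b≡0) ∘ m*n≡0⇒m≡0∨n≡0 (f i)
    left : ∀ {i} → i < k → b (suc i) ≡ 1 → f (suc i) * g (suc i) ≡ 0 → f i * g i ≡ 0
    left {i} i<k b≡1 = zero-product (f i) (g i)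
                     ∘ Sum.map (zero-left f-lag i<k b≡1) (zero-left g-lag i<k b≡1) ∘ m*n≡0⇒m≡0∨n≡0 (f (suc i))

  top : ℕ → ℕ
  top zero    = 0
  top (suc j) with suc j ≤? r
  ... | yes _ = 1
  ... | no  _ = 0

  top-inside : ∀ j → 1 ≤ j → j ≤ r → top j ≡ 1
  top-inside (suc j) _ j<r with suc j ≤? r
  ... | yes _   = refl
  ... | no  j≮r = ⊥-elim (j≮r j<r)

  top-outside : ∀ j → r < j → top j ≡ 0
  top-outside (suc j) r<j with suc j ≤? r
  ... | yes j≤r = ⊥-elim (<⇒≱ r<j j≤r)
  ... | no  _   = refl

  top≤1 : ∀ j → top j ≤ 1
  top≤1 zero = z≤n
  top≤1 (suc j) with suc j ≤? r
  ... | yes _ = ≤-refl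
  ... | no  _ = z≤n

  top-IsLag : IsLag top
  top-IsLag = record { ≤1 = top≤1 ; at-0 = refl ; beyond-r = top-outside ; step = top-step }
    where
    top-step : ∀ i → i < k → LagStep (b (suc i)) (top i) (top (suc i))
    top-step zero _ with ≤-<-connex 1 r
    ... | inj₁ 1≤r = step-cast b₁≡1 refl (top-inside 1 ≤-refl 1≤r) step-01
    ... | inj₂ r<1 = step-cast refl refl (top-outside 1 r<1) (step-00 (b≤1 1))
    top-step (suc i) _ with ≤-<-connex (suc (suc i)) r | ≤-<-connex (suc i) r
    ... | inj₁ i+2≤r | _         = step-cast refl (top-inside (suc i) (s≤s z≤n) (≤-trans (n≤1+n _) i+2≤r))
                                      (top-inside (suc (suc i)) (s≤s z≤n) i+2≤r) (step-11 (b≤1 _))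
    ... | inj₂ r<i+2 | inj₁ i+1≤r = step-cast b≡0 (top-inside (suc i) (s≤s z≤n) i+1≤r) (top-outside (suc (suc i)) r<i+2) step-10
      where
      r≡ : suc i ≡ r
      r≡ = ≤-antisym i+1≤r (≤-pred r<i+2)
      b≡0 : b (suc (suc i)) ≡ 0
      b≡0 = subst (λ j → b (suc j) ≡ 0) (sym r≡) (b-after-r (subst (1 ≤_) r≡ (s≤s z≤n)))
    ... | inj₂ r<i+2 | inj₂ r<i+1 = step-cast refl (top-outside (suc i) r<i+1) (top-outside (suc (suc i)) r<i+2)
                                      (step-00 (b≤1 _))

  lag≤top : ∀ {t} → IsLag t → ∀ j → t j ≤ top j
  lag≤top t-lag zero = ≤-reflexive (IsLag.at-0 t-lag)
  lag≤top t-lag (suc j) with ≤-<-connex (suc j) r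
  ... | inj₁ j<r = subst (_ ≤_) (sym (top-inside (suc j) (s≤s z≤n) j<r)) (IsLag.≤1 t-lag (suc j))
  ... | inj₂ r≤j = ≤-reflexive (trans (IsLag.beyond-r t-lag (suc j) r≤j) (sym (top-outside (suc j) r≤j)))

  lag≡1⇒inside : ∀ {u} → IsLag u → ∀ j → u j ≡ 1 → 1 ≤ j × j ≤ r
  lag≡1⇒inside u-lag zero    u0≡1 with () ← trans (sym (IsLag.at-0 u-lag)) u0≡1
  lag≡1⇒inside u-lag (suc j) uj≡1 with ≤-<-connex (suc j) r
  ... | inj₁ j<r = s≤s z≤n , j<r
  ... | inj₂ r≤j with () ← trans (sym (IsLag.beyond-r u-lag (suc j) r≤j)) uj≡1

  lag-minimum : ∀ {z} → IsMinimum n z → ∀ j → lag z j ≡ top j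
  lag-minimum {z} (hz , z≼) j = ≤-antisym (lag≤top (Expansion.lag-IsLag hz) j)
    (subst (_≤ lag z j) (FromLag.lag-word top-IsLag j) (≼⇒lag-≥ hz word-IsHB (z≼ word word-IsHB) j))
    where open FromLag top-IsLag using (word; word-IsHB)

  glue-IsLag : ∀ {m f g} → IsLag f → IsLag g → LagStep (b (suc m)) (f m) (g (suc m)) → IsLag (glue m f g)
  glue-IsLag {m} {f} {g} f-lag g-lag seam = record
    { ≤1       = λ j → glue-elim f g (_≤ 1) (λ _ → F.≤1 j) (λ _ → G.≤1 j)
    ; at-0     = trans (glue-≤ f g {0} (z≤n {m})) F.at-0
    ; beyond-r = λ j r<j → glue-elim f g (_≡ 0) (λ _ → F.beyond-r j r<j) (λ _ → G.beyond-r j r<j)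
    ; step     = glue-step
    }
    where
    module F = IsLag f-lag
    module G = IsLag g-lag
    glue-step : ∀ i → i < k → LagStep (b (suc i)) (glue m f g i) (glue m f g (suc i))
    glue-step i i<k with <-cmp i m
    ... | tri< i<m _ _  = step-cast refl (glue-≤ f g (<⇒≤ i<m)) (glue-≤ f g i<m) (F.step i i<k)
    ... | tri≈ _ refl _ = step-cast refl (glue-≤ f g ≤-refl) (glue-> f g (n<1+n m)) seam
    ... | tri> _ _ m<i  = step-cast refl (glue-> f g m<i) (glue-> f g (m<n⇒m<1+n m<i)) (G.step i i<k)

-- Join-irreducible expansions

module JoinIrreducibles (n : ℕ) (1≤n : 1 ≤ n) {z : List ℕ} (z-min : IsMinimum n z) {e : List ℕ} (he : IsHB n e) where
  open Lags n 1≤n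

  t : ℕ → ℕ
  t = lag e

  t-lag : IsLag t
  t-lag = Expansion.lag-IsLag he

  open IsLag t-lag using (≤1)

  sTilde≡1⊖lag : ∀ j → 1 ≤ j → j ≤ r → sTilde z e j ≡ 1 ℤ.⊖ t j
  sTilde≡1⊖lag j 1≤j j≤r = begin
    ℤ.+ s j e ℤ.- ℤ.+ s j z           ≡⟨ [+m]-[+n]≡m⊖n (s j e) (s j z) ⟩
    s j e ℤ.⊖ s j z                   ≡⟨ +-cancelˡ-⊖ (t j) (s j e) (s j z) ⟨
    (t j + s j e) ℤ.⊖ (t j + s j z)   ≡⟨ cong₂ ℤ._⊖_ (trans (+-comm (t j) (s j e)) balance) (+-comm (t j) (s j z)) ⟩
    (s j z + 1) ℤ.⊖ (s j z + t j)     ≡⟨ +-cancelˡ-⊖ (s j z) 1 (t j) ⟩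
    1 ℤ.⊖ t j                         ∎
    where
    open ≡-Reasoning
    j≤k = ≤-trans j≤r (<⇒≤ r<k)
    balance : s j e + t j ≡ s j z + 1
    balance = begin
      s j e + t j      ≡⟨ Expansion.s+lag he j j≤k ⟩
      N j              ≡⟨ Expansion.s+lag (proj₁ z-min) j j≤k ⟨
      s j z + lag z j  ≡⟨ cong (s j z +_) (trans (lag-minimum z-min j) (top-inside j 1≤j j≤r)) ⟩
      s j z + 1        ∎

  -- together with lag-downset: the zero set of t inside 1 … r is exactly ↓ x
  PrincipalAt : ℕ → Set
  PrincipalAt x = 1 ≤ x × x ≤ r × t x ≡ 0 × (∀ j → 1 ≤ j → j ≤ r → ¬ j ≤F[ n ] x → t j ≡ 1)

  indicator⇒principal : IsPrincipalIdealIndicator n (sTilde z e) → ∃[ x ] PrincipalAt x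
  indicator⇒principal (x , 1≤x , x≤r , indicator) =
    x , 1≤x , x≤r , lag≡0 x 1≤x x≤r (proj₁ (indicator x 1≤x x≤r) ε) ,
    λ j 1≤j j≤r j≰x → lag≡1 j 1≤j j≤r (proj₂ (indicator j 1≤j j≤r) j≰x)
    where
    lag≡0 : ∀ j → 1 ≤ j → j ≤ r → sTilde z e j ≡ ℤ.+ 1 → t j ≡ 0
    lag≡0 j 1≤j j≤r s̃≡1 with n≤1⇒n≡0∨n≡1 (≤1 j)
    ... | inj₁ tj≡0 = tj≡0
    ... | inj₂ tj≡1 with () ← trans (sym s̃≡1) (trans (sTilde≡1⊖lag j 1≤j j≤r) (cong (1 ℤ.⊖_) tj≡1))
    lag≡1 : ∀ j → 1 ≤ j → j ≤ r → sTilde z e j ≡ ℤ.+ 0 → t j ≡ 1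
    lag≡1 j 1≤j j≤r s̃≡0 with n≤1⇒n≡0∨n≡1 (≤1 j)
    ... | inj₂ tj≡1 = tj≡1
    ... | inj₁ tj≡0 with () ← trans (sym s̃≡0) (trans (sTilde≡1⊖lag j 1≤j j≤r) (cong (1 ℤ.⊖_) tj≡0))

  principal⇒indicator : ∀ {x} → PrincipalAt x → IsPrincipalIdealIndicator n (sTilde z e)
  principal⇒indicator {x} (1≤x , x≤r , tx≡0 , outside) = x , 1≤x , x≤r , λ j 1≤j j≤r →
    (λ j≤x → trans (sTilde≡1⊖lag j 1≤j j≤r) (cong (1 ℤ.⊖_) (lag-downset t-lag j≤x tx≡0))) ,
    (λ j≰x → trans (sTilde≡1⊖lag j 1≤j j≤r) (cong (1 ℤ.⊖_) (outside j 1≤j j≤r j≰x)))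

  principal⇒irreducible : ∀ {x} → PrincipalAt x → JoinIrreducible n e
  principal⇒irreducible {x} (1≤x , x≤r , tx≡0 , outside) = not-minimum , irreducible
    where
    not-minimum : ¬ (∀ y → IsHB n y → e ≼ y)
    not-minimum e≼ = 1+n≰n (subst₂ _≤_ (trans (lag-minimum z-min x) (top-inside x 1≤x x≤r)) tx≡0
                                       (≼⇒lag-≥ he (proj₁ z-min) (e≼ z (proj₁ z-min)) x))

    absorbs : ∀ {a} → IsHB n a → a ≼ e → lag a x ≡ 0 → e ≡ a
    absorbs {a} ha a≼e ax≡0 = lag-injective he ha lag≡
      where
      a-lag = Expansion.lag-IsLag ha
      lag≡ : ∀ j → t j ≡ lag a j
      lag≡ j with n≤1⇒n≡0∨n≡1 (IsLag.≤1 a-lag j)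
      ... | inj₁ aj≡0 = trans (n≤0⇒n≡0 (subst (t j ≤_) aj≡0 (≼⇒lag-≥ ha he a≼e j))) (sym aj≡0)
      ... | inj₂ aj≡1 = trans (outside j (proj₁ inside) (proj₂ inside) j≰x) (sym aj≡1)
        where
        inside = lag≡1⇒inside a-lag j aj≡1
        j≰x : ¬ j ≤F[ n ] x
        j≰x j≤x = 0≢1+n (trans (sym (lag-downset a-lag j≤x ax≡0)) aj≡1)

    irreducible : ∀ a c → IsHB n a → IsHB n c → IsJoin n a c e → e ≡ a ⊎ e ≡ c
    irreducible a c ha hc (_ , a≼e , c≼e , least)
      with n≤1⇒n≡0∨n≡1 (Expansion.lag≤1 ha x) | n≤1⇒n≡0∨n≡1 (Expansion.lag≤1 hc x)
    ... | inj₁ ax≡0 | _         = inj₁ (absorbs ha a≼e ax≡0)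
    ... | inj₂ _    | inj₁ cx≡0 = inj₂ (absorbs hc c≼e cx≡0)
    ... | inj₂ ax≡1 | inj₂ cx≡1 = ⊥-elim (1+n≰n (subst₂ _≤_ ux≡1 tx≡0 (≼⇒lag-≥ he u-HB (least u u-HB a≼u c≼u) x)))
      where
      open FromLag (lag-* (Expansion.lag-IsLag ha) (Expansion.lag-IsLag hc))
        renaming (word to u; word-IsHB to u-HB; lag-word to lag-u)
      a≼u : a ≼ u
      a≼u = lag-≥⇒≼ ha u-HB λ j → subst (_≤ lag a j) (sym (lag-u j)) (m*n≤m (lag a j) (Expansion.lag≤1 hc j))
      c≼u : c ≼ u
      c≼u = lag-≥⇒≼ hc u-HB λ j → subst (_≤ lag c j) (sym (lag-u j)) (m*n≤n (lag c j) (Expansion.lag≤1 ha j))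
      ux≡1 : lag u x ≡ 1
      ux≡1 = trans (lag-u x) (cong₂ _*_ ax≡1 cx≡1)

  module _ (irreducible : JoinIrreducible n e) where

    -- e is the join of the expansions whose zero sets are the parts of its own up to m and beyond m′,
    -- both lags thanks to the seams; neither is e, by j₁ and j₂
    no-split : ∀ m m′ → m′ ≤ m → LagStep (b (suc m)) (t m) (top (suc m)) → LagStep (b (suc m′)) (top m′) (t (suc m′)) →
      ∀ {j₁ j₂} → m < j₁ → j₁ ≤ r → t j₁ ≡ 0 → 1 ≤ j₂ → j₂ ≤ m′ → t j₂ ≡ 0 → ⊥
    no-split m m′ m′≤m seam seam′ {j₁} {j₂} m<j₁ j₁≤r tj₁≡0 1≤j₂ j₂≤m′ tj₂≡0 =
      [ e≢a , e≢c ]′ (proj₂ irreducible a c a-HB c-HB (he , a≼e , c≼e , least))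
      where
      open FromLag (glue-IsLag t-lag top-IsLag seam) renaming (word to a; word-IsHB to a-HB; lag-word to lag-a)
      open FromLag (glue-IsLag top-IsLag t-lag seam′) renaming (word to c; word-IsHB to c-HB; lag-word to lag-c)
      a≼e : a ≼ e
      a≼e = lag-≥⇒≼ a-HB he λ j → subst (t j ≤_) (sym (lag-a j))
              (glue-elim {m} {j} t top (t j ≤_) (λ _ → ≤-refl) (λ _ → lag≤top t-lag j))
      c≼e : c ≼ e
      c≼e = lag-≥⇒≼ c-HB he λ j → subst (t j ≤_) (sym (lag-c j))
              (glue-elim {m′} {j} top t (t j ≤_) (λ _ → lag≤top t-lag j) (λ _ → ≤-refl))
      least : ∀ u → IsHB n u → a ≼ u → c ≼ u → e ≼ u
      least u hu a≼u c≼u = lag-≥⇒≼ he hu λ j → [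
        (λ j≤m → subst (lag u j ≤_) (trans (lag-a j) (glue-≤ t top j≤m)) (≼⇒lag-≥ a-HB hu a≼u j)) ,
        (λ m<j → subst (lag u j ≤_) (trans (lag-c j) (glue-> top t (≤-<-trans m′≤m m<j))) (≼⇒lag-≥ c-HB hu c≼u j)) ]′
        (≤-<-connex j m)
      e≢a : e ≢ a
      e≢a e≡a = 0≢1+n (begin
        0                 ≡⟨ tj₁≡0 ⟨
        t j₁              ≡⟨ cong (λ w → lag w j₁) e≡a ⟩
        lag a j₁          ≡⟨ lag-a j₁ ⟩
        glue m t top j₁   ≡⟨ glue-> t top m<j₁ ⟩
        top j₁            ≡⟨ top-inside j₁ (≤-trans (s≤s z≤n) m<j₁) j₁≤r ⟩
        1                 ∎)
        where open ≡-Reasoning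
      e≢c : e ≢ c
      e≢c e≡c = 0≢1+n (begin
        0                 ≡⟨ tj₂≡0 ⟨
        t j₂              ≡⟨ cong (λ w → lag w j₂) e≡c ⟩
        lag c j₂          ≡⟨ lag-c j₂ ⟩
        glue m′ top t j₂  ≡⟨ glue-≤ top t j₂≤m′ ⟩
        top j₂            ≡⟨ top-inside j₂ 1≤j₂ (≤-trans j₂≤m′ (≤-trans m′≤m (<⇒≤ (<-≤-trans m<j₁ j₁≤r)))) ⟩
        1                 ∎)
        where open ≡-Reasoning

    no-gap : ∀ {y j₁ j₂} → t (suc y) ≡ 1 → suc y ≤ r →
      1 ≤ j₂ → j₂ ≤ y → t j₂ ≡ 0 → y < j₁ → j₁ ≤ r → t j₁ ≡ 0 → ⊥
    no-gap {y} gap y<r 1≤j₂ j₂≤y tj₂≡0 y<j₁ j₁≤r tj₁≡0 =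
      no-split y y ≤-refl seam seam′ y<j₁ j₁≤r tj₁≡0 1≤j₂ j₂≤y tj₂≡0
      where
      seam : LagStep (b (suc y)) (t y) (top (suc y))
      seam = step-at t-lag (≤-trans y<r (<⇒≤ r<k)) refl refl (trans gap (sym (top-inside (suc y) (s≤s z≤n) y<r)))
      seam′ : LagStep (b (suc y)) (top y) (t (suc y))
      seam′ = step-cast refl (top-inside y (≤-trans 1≤j₂ j₂≤y) (≤-trans (n≤1+n y) y<r)) gap (step-11 (b≤1 (suc y)))

    no-valley : ∀ {x y} → 1 ≤ x → x < y → suc y ≤ r →
      t x ≡ 0 → t y ≡ 0 → t (suc y) ≡ 0 → b y ≡ 0 → b (suc y) ≡ 1 → ⊥
    no-valley {x} {suc y} 1≤x (s≤s x≤y) y<r tx≡0 ty≡0 next≡0 by≡0 next-b≡1 =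
      no-split (suc y) y (n≤1+n y) seam seam′ (n<1+n (suc y)) y<r next≡0 1≤x x≤y tx≡0
      where
      seam : LagStep (b (suc (suc y))) (t (suc y)) (top (suc (suc y)))
      seam = step-cast next-b≡1 ty≡0 (top-inside (suc (suc y)) (s≤s z≤n) y<r) step-01
      seam′ : LagStep (b (suc y)) (top y) (t (suc y))
      seam′ = step-cast by≡0 (top-inside y (≤-trans 1≤x x≤y) (≤-trans (n≤1+n y) (≤-trans (n≤1+n (suc y)) y<r)))
                        ty≡0 step-10

    module _ {p} (1≤p : 1 ≤ p) (tp≡0 : t p ≡ 0) where

      Peak : Set
      Peak = ∃[ x ] 1 ≤ x × x ≤ r × t x ≡ 0 × (∀ i → p ≤ i → i ≤ r → t i ≡ 0 → i ≤F[ n ] x)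

      -- invariant of the walk from p to y: p … y lie below the peak, and b y ≡ 0 once the walk is past it
      record Climb (y : ℕ) : Set where
        field
          peak       : ℕ
          p≤peak     : p ≤ peak
          peak≤y     : peak ≤ y
          y≤r        : y ≤ r
          peak-zero  : t peak ≡ 0
          below-peak : ∀ i → p ≤ i → i ≤ y → i ≤F[ n ] peak
          shape      : peak ≡ y ⊎ (peak < y × b y ≡ 0)

      module Advance {y} (y<r : suc y ≤ r) (st : Climb y) where
        open Climb st

        p≤y = ≤-trans p≤peak peak≤y
        1≤y = ≤-trans 1≤p p≤y

        stop : t (suc y) ≡ 1 → Peak
        stop gap = peak , ≤-trans 1≤p p≤peak , ≤-trans peak≤y y≤r , peak-zero , λ i p≤i i≤r ti≡0 →
          [ below-peak i p≤i , (λ y<i → ⊥-elim (no-gap gap y<r 1≤p p≤y tp≡0 y<i i≤r ti≡0)) ]′ (≤-<-connex i y)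

        extend : ∀ {x} → (∀ i → p ≤ i → i ≤ y → i ≤F[ n ] x) → suc y ≤F[ n ] x →
          ∀ i → p ≤ i → i ≤ suc y → i ≤F[ n ] x
        extend old new i p≤i i≤y+1 = [ (λ i<y+1 → old i p≤i (≤-pred i<y+1)) , (λ { refl → new }) ]′ (m≤n⇒m<n∨m≡n i≤y+1)

        descend : b (suc y) ≡ 0 → t (suc y) ≡ 0 → Climb (suc y)
        descend b≡0 next≡0 = record
          { peak = peak ; p≤peak = p≤peak ; peak≤y = m≤n⇒m≤1+n peak≤y ; y≤r = y<r ; peak-zero = peak-zero
          ; below-peak = extend below-peak (down (s≤s 1≤y) y<r b≡0 ◅ below-peak y p≤y ≤-refl)
          ; shape = inj₂ (s≤s peak≤y , b≡0) }

        ascend : b (suc y) ≡ 1 → t (suc y) ≡ 0 → peak ≡ y → Climb (suc y)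
        ascend b≡1 next≡0 refl = record
          { peak = suc y ; p≤peak = m≤n⇒m≤1+n p≤y ; peak≤y = ≤-refl ; y≤r = y<r ; peak-zero = next≡0
          ; below-peak = extend (λ i p≤i i≤y → below-peak i p≤i i≤y ◅◅ (up (s≤s 1≤y) y<r b≡1 ◅ ε)) ε
          ; shape = inj₁ refl }

        advance : Peak ⊎ Climb (suc y)
        advance with n≤1⇒n≡0∨n≡1 (≤1 (suc y)) | n≤1⇒n≡0∨n≡1 (b≤1 (suc y)) | shape
        ... | inj₂ gap    | _        | _                    = inj₁ (stop gap)
        ... | inj₁ next≡0 | inj₁ b≡0 | _                    = inj₂ (descend b≡0 next≡0)
        ... | inj₁ next≡0 | inj₂ b≡1 | inj₁ peak≡y          = inj₂ (ascend b≡1 next≡0 peak≡y)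
        ... | inj₁ next≡0 | inj₂ b≡1 | inj₂ (peak<y , by≡0) = ⊥-elim (no-valley (≤-trans 1≤p p≤peak) peak<y y<r
          peak-zero (lag-downset t-lag (below-peak y p≤y ≤-refl) peak-zero) next≡0 by≡0 b≡1)

      climb : ∀ d {y} → y + d ≡ r → Climb y → Peak
      climb zero    {y} y+0≡r st = peak , ≤-trans 1≤p p≤peak , ≤-trans peak≤y y≤r , peak-zero ,
        λ i p≤i i≤r _ → below-peak i p≤i (subst (i ≤_) (trans (sym y+0≡r) (+-identityʳ y)) i≤r)
        where open Climb st
      climb (suc d) {y} y+d≡r st = [ (λ peak → peak) , climb d (trans (sym (+-suc y d)) y+d≡r) ]′
        (Advance.advance (subst (suc y ≤_) y+d≡r (m<m+n y (s≤s z≤n))) st)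

    irreducible⇒principal : ∃[ x ] PrincipalAt x
    irreducible⇒principal with least-or-none (λ i → (1 ≤? i) ×-dec (t i ≟ 0)) r
    ... | inj₂ none = ⊥-elim (proj₁ irreducible λ y hy →
                        lag-≥⇒≼ he hy λ j → ≤-trans (lag≤top (Expansion.lag-IsLag hy) j) (top≤t j))
      where
      top≤t : ∀ j → top j ≤ t j
      top≤t j with n≤1⇒n≡0∨n≡1 (top≤1 j)
      ... | inj₁ top≡0 = subst (_≤ t j) (sym top≡0) z≤n
      ... | inj₂ top≡1 = subst (_≤ t j) (sym top≡1) (n≢0⇒n>0 (λ tj≡0 → none j (proj₂ inside) (proj₁ inside , tj≡0)))
        where inside = lag≡1⇒inside top-IsLag j top≡1
    ... | inj₁ (p , p≤r , (1≤p , tp≡0) , below-p) with climb 1≤p tp≡0 (r ∸ p) (m+[n∸m]≡n p≤r) start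
      where
      start : Climb 1≤p tp≡0 p
      start = record { peak = p ; p≤peak = ≤-refl ; peak≤y = ≤-refl ; y≤r = p≤r ; peak-zero = tp≡0
                     ; below-peak = λ i p≤i i≤p → subst (_≤F[ n ] p) (≤-antisym p≤i i≤p) ε ; shape = inj₁ refl }
    ... | x , 1≤x , x≤r , tx≡0 , below-x = x , 1≤x , x≤r , tx≡0 , outside
      where
      outside : ∀ j → 1 ≤ j → j ≤ r → ¬ j ≤F[ n ] x → t j ≡ 1
      outside j 1≤j j≤r j≰x with n≤1⇒n≡0∨n≡1 (≤1 j)
      ... | inj₂ tj≡1 = tj≡1
      ... | inj₁ tj≡0 = ⊥-elim ([ (λ j<p → below-p j j<p (1≤j , tj≡0)) , (λ p≤j → j≰x (below-x j p≤j j≤r tj≡0)) ]′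
                                  (<-≤-connex j p))

proposition3p14 : (n : ℕ) → 1 ≤ n → (z : List ℕ) → IsMinimum n z →
    (e : List ℕ) → IsHB n e →
    JoinIrreducible n e ⇔ IsPrincipalIdealIndicator n (sTilde z e)
proposition3p14 n 1≤n z z-min e he =
  mk⇔ (λ irreducible → principal⇒indicator (proj₂ (irreducible⇒principal irreducible)))
      (λ indicator → principal⇒irreducible (proj₂ (indicator⇒principal indicator)))
  where open JoinIrreducibles n 1≤n z-min he
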